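{- Let $\mathbb{B}=\{0,1\}$ and, for every odd $k\ge 1$, let $M_k:\mathbb{B}^k\to\mathbb{B}$ be the $k$-input majority function, $M_k(x_1,\dots,x_k)=1$ if and only if at least $\lceil k/2\rceil$ of the $x_i$ equal $1$ (so $M_1(x)=x$). Let $\neg$ denote Boolean complementation. Fix an odd integer $n\ge 3$. Then each of the following identities holds for all values in $\mathbb{B}$ of the variables occurring in it: <ol> <li>(Commutativity) For all $1\le i<j\le n$: $M_n(x_1,\dots,x_{i-1},x_i,x_{i+1},\dots,x_{j-1},x_j,x_{j+1},\dots,x_n)=M_n(x_1,\dots,x_{i-1},x_j,x_{i+1},\dots,x_{j-1},x_i,x_{j+1},\dots,x_n)$.</li> <li>(Majority) If at least $\lceil n/2\rceil$ of the entries of $(x_1,\dots,x_n)$ are equal to $y$, then $M_n(x_1,\dots,x_n)=y$. If $x_i\neq x_j$ for some $i\neq j$ (i.e. $x_j=\neg x_i$), then $M_n(x_1,\dots,x_n)=M_{n-2}(y_1,\dots,y_{n-2})$, where $(y_1,\dots,y_{n-2})$ is obtained from $(x_1,\dots,x_n)$ by removing the entries $x_i$ and $x_j$.</li> <li>(Associativity) $M_n(z_1,\dots,z_{n-2},y,M_n(z_1,\dots,z_{n-2},x,w))=M_n(z_1,\dots,z_{n-2},x,M_n(z_1,\dots,z_{n-2},y,w))$.</li> <li>(Distributivity) For every integer $k$ with $\lceil n/2\rceil\le k\le n-1$: $M_n(x_1,\dots,x_{n-1},M_n(y_1,\dots,y_n))=M_n\big(M_n(x_1,\dots,x_{n-1},y_1),\dots,M_n(x_1,\dots,x_{n-1},y_k),y_{k+1},\dots,y_n\big)$.</li>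 <li>(Inverter propagation) $\neg M_n(x_1,\dots,x_n)=M_n(\neg x_1,\dots,\neg x_n)$.</li> </ol>
   Context: The algebraic structure considered is $(\mathbb{B},M_n,\neg,0,1)$, where "$M_n$" is understood to include every $M_i$ with $i\le n$ odd. The five identities above are called the axiom set $\Omega_n$; the theorem asserts that each axiom of $\Omega_n$ is sound (valid) in $(\mathbb{B},M_n,\neg,0,1)$. -}

module Defs where

open import Data.Bool using (Bool; true; false; not; if_then_else_)
open import Data.Bool.Properties using () renaming (_≟_ to _≟B_)
open import Data.Nat using (ℕ; zero; suc; _+_; _≤ᵇ_; ⌈_/2⌉)
open import Data.Fin using (Fin; zero; suc; fromℕ; punchOut)
open import Data.Fin.Properties using () renaming (_≟_ to _≟F_)
open import Data.Vec.Functional using (Vector; insertAt; removeAt)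
open import Relation.Nullary using (¬_)
open import Relation.Nullary.Decidable using (⌊_⌋)
open import Relation.Binary.PropositionalEquality using (_≡_)

-- 𝔹 = Bool (false = 0, true = 1); tuples in 𝔹^k are functions Fin k → Bool.

count1 : {k : ℕ} → Vector Bool k → ℕ
count1 {zero}  x = 0
count1 {suc k} x = (if x zero then 1 else 0) + count1 (λ l → x (suc l))

countEq : {k : ℕ} → Bool → Vector Bool k → ℕ
countEq y x = count1 (λ l → ⌊ x l ≟B y ⌋)

Maj : (k : ℕ) → Vector Bool k → Bool
Maj k x = ⌈ k /2⌉ ≤ᵇ count1 x

swapEntries : {k : ℕ} → Vector Bool k → Fin k → Fin k → Vector Bool k
swapEntries x i j l =
  if ⌊ l ≟F i ⌋ then x j else (if ⌊ l ≟F j ⌋ then x i else x l)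

removeTwo : {k : ℕ} → Vector Bool (suc (suc k)) → (i j : Fin (suc (suc k))) →
            ¬ (i ≡ j) → Vector Bool k
removeTwo x i j i≢j = removeAt (removeAt x i) (punchOut i≢j)

snoc : {k : ℕ} → Vector Bool k → Bool → Vector Bool (suc k)
snoc {k} x a = insertAt x (fromℕ k) a

module Submission where

-- Everything is reduced to counting ones.  M_n x is the threshold test
-- ⌈n/2⌉ ≤ᵇ count1 x, so the axioms become facts about count1 and about
-- Boolean threshold tests:
--   * count1 is invariant under swapping two entries, drops by exactly one
--     when a complementary pair is removed, and count1 x + count1 (¬x) = n;
--     these give commutativity, cancellation of a complementary pair and
--     (for odd n, where "fewer than half are 1" means "at least half are 0")
--     inverter propagation, and with it the majority axiom.
--   * Fixing all but the last one or two arguments of M_n leaves a threshold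
--     gate d ≤ᵇ (number of true inputs) with d = ⌈n/2⌉ ∸ count1 (context).
--     A binary gate is constantly true, ∨, ∧ or constantly false, each of
--     which satisfies the exchange law; this is associativity.  A unary gate
--     is constant or the identity; in the identity case distributivity holds
--     entrywise, in a constant case both sides equal that constant because
--     at least ⌈n/2⌉ entries of the right-hand side do (majority axiom).

open import Defs
open import Algebra.Bundles using (CommutativeMonoid)
import Algebra.Properties.CommutativeSemigroup as CommutativeSemigroupProperties
open import Data.Bool using (Bool; true; false; not; if_then_else_; _∧_; _∨_)
open import Data.Bool.Properties
  using (T-≡; not-involutive; ∨-commutativeMonoid; ∧-commutativeMonoid)
  renaming (_≟_ to _≟B_)
open import Data.Nat using (ℕ; zero; suc; _+_; _*_; _∸_; _≤_; _<_; _<ᵇ_; _≤ᵇ_; ⌈_/2⌉; ⌊_/2⌋; z≤n; s≤s)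
open import Data.Nat.Properties
  using (≤⇒≤ᵇ; ≤ᵇ-reflects-≤; <⇒≱; ≤-trans; ≤-reflexive; ≤-pred; m≤n⇒m≤1+n; _≤?_; ≰⇒>;
         +-suc; +-assoc; +-identityʳ; +-cancelʳ-≤; +-monoʳ-≤; +-mono-≤; n≡⌊n+n/2⌋;
         +-commutativeSemigroup)
open import Data.Nat.Tactic.RingSolver using (solve-∀)
open import Data.Fin using (Fin; toℕ; zero; suc; punchIn; punchOut)
open import Data.Fin.Properties using (<⇒≢; punchInᵢ≢i; punchIn-punchOut; punchIn-injective)
  renaming (_≟_ to _≟F_)
open import Data.Product using (_×_; _,_)
open import Data.Sum using (_⊎_; inj₁; inj₂)
open import Data.Vec.Functional using (Vector; removeAt)
open import Function using (_∘_; Equivalence)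
open import Relation.Nullary using (¬_; yes; no; contradiction)
open import Relation.Nullary.Decidable using (⌊_⌋)
open import Relation.Nullary.Reflects using (ofʸ)
open import Relation.Binary.PropositionalEquality
open ≡-Reasoning

open CommutativeSemigroupProperties +-commutativeSemigroup
  using () renaming (x∙yz≈y∙xz to +-exchange; interchange to +-interchange)
open CommutativeSemigroupProperties (CommutativeMonoid.commutativeSemigroup ∨-commutativeMonoid)
  using () renaming (x∙yz≈y∙xz to ∨-exchange)
open CommutativeSemigroupProperties (CommutativeMonoid.commutativeSemigroup ∧-commutativeMonoid)
  using () renaming (x∙yz≈y∙xz to ∧-exchange)

bit : Bool → ℕ
bit b = if b then 1 else 0

≤ᵇ-true : ∀ {a b} → a ≤ b → (a ≤ᵇ b) ≡ true
≤ᵇ-true a≤b = Equivalence.to T-≡ (≤⇒≤ᵇ a≤b)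

≤ᵇ-false : ∀ {a b} → b < a → (a ≤ᵇ b) ≡ false
≤ᵇ-false {a} {b} b<a with a ≤ᵇ b | ≤ᵇ-reflects-≤ a b
... | true  | ofʸ a≤b = contradiction a≤b (<⇒≱ b<a)
... | false | _       = refl

suc-≤ᵇ : ∀ a b → (suc a ≤ᵇ suc b) ≡ (a ≤ᵇ b)
suc-≤ᵇ zero    b = refl
suc-≤ᵇ (suc a) b = refl

≤ᵇ-∸ : ∀ t c s → (t ≤ᵇ c + s) ≡ (t ∸ c ≤ᵇ s)
≤ᵇ-∸ t       zero    s = refl
≤ᵇ-∸ zero    (suc c) s = refl
≤ᵇ-∸ (suc t) (suc c) s = trans (suc-≤ᵇ t (c + s)) (≤ᵇ-∸ t c s)

threshold-complement : ∀ h a b → a + b ≡ suc (h + h) → not (suc h ≤ᵇ a) ≡ (suc h ≤ᵇ b)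
threshold-complement h a b a+b≡n with suc h ≤? b
... | yes h<b = trans (cong not (≤ᵇ-false (s≤s a≤h))) (sym (≤ᵇ-true h<b))
  where
  a≤h : a ≤ h
  a≤h = +-cancelʳ-≤ (suc h) a h
          (≤-trans (+-monoʳ-≤ a h<b) (≤-reflexive (trans a+b≡n (sym (+-suc h h)))))
... | no h≮b = trans (cong not (≤ᵇ-true h<a)) (sym (≤ᵇ-false (≰⇒> h≮b)))
  where
  h<a : suc h ≤ a
  h<a = +-cancelʳ-≤ h (suc h) a
          (≤-trans (≤-reflexive (sym a+b≡n)) (+-monoʳ-≤ a (≤-pred (≰⇒> h≮b))))

count1-ext : ∀ {k} (f g : Vector Bool k) → (∀ l → f l ≡ g l) → count1 f ≡ count1 g
count1-ext {zero}  f g f≗g = refl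
count1-ext {suc k} f g f≗g =
  cong₂ _+_ (cong bit (f≗g zero)) (count1-ext (f ∘ suc) (g ∘ suc) (f≗g ∘ suc))

count1-mono : ∀ {k} (f g : Vector Bool k) → (∀ l → f l ≡ true → g l ≡ true) →
              count1 f ≤ count1 g
count1-mono {zero}  f g f⇒g = z≤n
count1-mono {suc k} f g f⇒g =
  +-mono-≤ (bit-mono (f zero) (g zero) (f⇒g zero))
           (count1-mono (f ∘ suc) (g ∘ suc) (f⇒g ∘ suc))
  where
  bit-mono : ∀ a b → (a ≡ true → b ≡ true) → bit a ≤ bit b
  bit-mono false b _   = z≤n
  bit-mono true  b a⇒b = ≤-reflexive (cong bit (sym (a⇒b refl)))

count1-complement : ∀ {k} (f : Vector Bool k) → count1 f + count1 (not ∘ f) ≡ k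
count1-complement {zero}  f = refl
count1-complement {suc k} f = begin
  (bit (f zero) + count1 (f ∘ suc)) + (bit (not (f zero)) + count1 (not ∘ f ∘ suc))
    ≡⟨ +-interchange (bit (f zero)) _ _ _ ⟩
  (bit (f zero) + bit (not (f zero))) + (count1 (f ∘ suc) + count1 (not ∘ f ∘ suc))
    ≡⟨ cong₂ _+_ (bit-complement (f zero)) (count1-complement (f ∘ suc)) ⟩
  suc k ∎
  where
  bit-complement : ∀ b → bit b + bit (not b) ≡ 1
  bit-complement true  = refl
  bit-complement false = refl

count1-snoc : ∀ {k} (z : Vector Bool k) a → count1 (snoc z a) ≡ count1 z + bit a
count1-snoc {zero}  z a = +-identityʳ (bit a)
count1-snoc {suc k} z a =
  trans (cong (bit (z zero) +_) (count1-snoc (z ∘ suc) a)) (sym (+-assoc (bit (z zero)) _ (bit a)))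

count1-removeAt : ∀ {k} (f : Vector Bool (suc k)) i → count1 f ≡ bit (f i) + count1 (removeAt f i)
count1-removeAt f       zero    = refl
count1-removeAt {suc k} f (suc i) = begin
  bit (f zero) + count1 (f ∘ suc)
    ≡⟨ cong (bit (f zero) +_) (count1-removeAt (f ∘ suc) i) ⟩
  bit (f zero) + (bit (f (suc i)) + count1 (removeAt (f ∘ suc) i))
    ≡⟨ +-exchange (bit (f zero)) (bit (f (suc i))) (count1 (removeAt (f ∘ suc) i)) ⟩
  bit (f (suc i)) + count1 (removeAt f (suc i)) ∎

count1-removeTwo : ∀ {k} (x : Vector Bool (suc (suc k))) i j (i≢j : ¬ i ≡ j) →
                   count1 x ≡ bit (x i) + (bit (x j) + count1 (removeTwo x i j i≢j))
count1-removeTwo x i j i≢j = begin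
  count1 x
    ≡⟨ count1-removeAt x i ⟩
  bit (x i) + count1 (removeAt x i)
    ≡⟨ cong (bit (x i) +_) (count1-removeAt (removeAt x i) (punchOut i≢j)) ⟩
  bit (x i) + (bit (x (punchIn i (punchOut i≢j))) + count1 (removeTwo x i j i≢j))
    ≡⟨ cong (λ l → bit (x i) + (bit (x l) + count1 (removeTwo x i j i≢j))) (punchIn-punchOut i≢j) ⟩
  bit (x i) + (bit (x j) + count1 (removeTwo x i j i≢j)) ∎

count1-swap : ∀ {k} (x : Vector Bool (suc (suc k))) i j (i≢j : ¬ i ≡ j) →
              count1 (swapEntries x i j) ≡ count1 x
count1-swap x i j i≢j = begin
  count1 s
    ≡⟨ count1-removeTwo s i j i≢j ⟩
  bit (s i) + (bit (s j) + count1 (removeTwo s i j i≢j))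
    ≡⟨ cong₂ (λ a b → bit a + (bit b + count1 (removeTwo s i j i≢j))) swap-at-i swap-at-j ⟩
  bit (x j) + (bit (x i) + count1 (removeTwo s i j i≢j))
    ≡⟨ cong (λ c → bit (x j) + (bit (x i) + c)) (count1-ext _ _ swap-elsewhere) ⟩
  bit (x j) + (bit (x i) + count1 (removeTwo x i j i≢j))
    ≡⟨ +-exchange (bit (x j)) (bit (x i)) (count1 (removeTwo x i j i≢j)) ⟩
  bit (x i) + (bit (x j) + count1 (removeTwo x i j i≢j))
    ≡⟨ count1-removeTwo x i j i≢j ⟨
  count1 x ∎
  where
  s = swapEntries x i j

  swap-at-i : s i ≡ x j
  swap-at-i with i ≟F i
  ... | yes _   = refl
  ... | no  i≢i = contradiction refl i≢i

  swap-at-j : s j ≡ x i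
  swap-at-j with j ≟F i | j ≟F j
  ... | yes j≡i | _       = contradiction (sym j≡i) i≢j
  ... | no  _   | yes _   = refl
  ... | no  _   | no  j≢j = contradiction refl j≢j

  -- the entries kept by removeTwo are neither i nor j, so s and x agree there
  swap-elsewhere : ∀ l → removeTwo s i j i≢j l ≡ removeTwo x i j i≢j l
  swap-elsewhere l with punchIn i (punchIn (punchOut i≢j) l) ≟F i
                      | punchIn i (punchIn (punchOut i≢j) l) ≟F j
  ... | yes l≡i | _       = contradiction l≡i (punchInᵢ≢i i _)
  ... | no  _   | yes l≡j = contradiction
          (punchIn-injective i _ _ (trans l≡j (sym (punchIn-punchOut i≢j))))
          (punchInᵢ≢i (punchOut i≢j) l)
  ... | no  _   | no  _   = refl

count1-prefix : ∀ {k} r → r ≤ k → count1 {k} (λ l → toℕ l <ᵇ r) ≡ r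
count1-prefix {zero}  zero    _         = refl
count1-prefix {suc k} zero    _         = count1-prefix {k} zero z≤n
count1-prefix {suc k} (suc r) (s≤s r≤k) = cong suc (count1-prefix r r≤k)

countEq-true : ∀ {k} (x : Vector Bool k) → countEq true x ≡ count1 x
countEq-true x = count1-ext _ x (λ l → is-true (x l))
  where
  is-true : ∀ b → ⌊ b ≟B true ⌋ ≡ b
  is-true true  = refl
  is-true false = refl

countEq-false : ∀ {k} (x : Vector Bool k) → countEq false x ≡ countEq true (not ∘ x)
countEq-false x = count1-ext _ _ (λ l → is-false (x l))
  where
  is-false : ∀ b → ⌊ b ≟B false ⌋ ≡ ⌊ not b ≟B true ⌋
  is-false true  = refl
  is-false false = refl

commutativity : ∀ {k} (x : Vector Bool (suc (suc k))) i j → ¬ i ≡ j →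
                Maj (suc (suc k)) x ≡ Maj (suc (suc k)) (swapEntries x i j)
commutativity {k} x i j i≢j = cong (⌈ suc (suc k) /2⌉ ≤ᵇ_) (sym (count1-swap x i j i≢j))

-- Cancellation of a complementary pair (any arity): the pair contributes
-- exactly one 1, and ⌈(k+2)/2⌉ = ⌈k/2⌉ + 1.
cancellation : ∀ {k} (x : Vector Bool (suc (suc k))) i j (i≢j : ¬ i ≡ j) → x j ≡ not (x i) →
               Maj (suc (suc k)) x ≡ Maj k (removeTwo x i j i≢j)
cancellation {k} x i j i≢j xj≡¬xi = begin
  suc ⌈ k /2⌉ ≤ᵇ count1 x
    ≡⟨ cong (suc ⌈ k /2⌉ ≤ᵇ_) (count1-removeTwo x i j i≢j) ⟩
  suc ⌈ k /2⌉ ≤ᵇ bit (x i) + (bit (x j) + c)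
    ≡⟨ cong (λ b → suc ⌈ k /2⌉ ≤ᵇ bit (x i) + (bit b + c)) xj≡¬xi ⟩
  suc ⌈ k /2⌉ ≤ᵇ bit (x i) + (bit (not (x i)) + c)
    ≡⟨ cong (suc ⌈ k /2⌉ ≤ᵇ_) (pair-counts-once (x i)) ⟩
  suc ⌈ k /2⌉ ≤ᵇ suc c
    ≡⟨ suc-≤ᵇ ⌈ k /2⌉ c ⟩
  ⌈ k /2⌉ ≤ᵇ c ∎
  where
  c = count1 (removeTwo x i j i≢j)

  pair-counts-once : ∀ b → bit b + (bit (not b) + c) ≡ suc c
  pair-counts-once true  = refl
  pair-counts-once false = refl

-- The exchange law y ∙ (x ∙ w) = x ∙ (y ∙ w) for a binary Boolean gate; the
-- associativity axiom says exactly that M_n(z, _, _) satisfies it.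
Exchange : (Bool → Bool → Bool) → Set
Exchange _∙_ = ∀ x y w → y ∙ (x ∙ w) ≡ x ∙ (y ∙ w)

exchange-ext : ∀ {f g : Bool → Bool → Bool} → (∀ a b → f a b ≡ g a b) → Exchange g → Exchange f
exchange-ext {f} {g} f≗g g-exchange x y w = begin
  f y (f x w)  ≡⟨ f≗g y _ ⟩
  g y (f x w)  ≡⟨ cong (g y) (f≗g x w) ⟩
  g y (g x w)  ≡⟨ g-exchange x y w ⟩
  g x (g y w)  ≡⟨ cong (g x) (f≗g y w) ⟨
  g x (f y w)  ≡⟨ f≗g x _ ⟨
  f x (f y w)  ∎

threshold₂ : ℕ → Bool → Bool → Bool
threshold₂ d a b = d ≤ᵇ bit a + bit b

-- It is constantly true, ∨, ∧ or constantly false; all four satisfy exchange.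
threshold₂-exchange : ∀ d → Exchange (threshold₂ d)
threshold₂-exchange zero                = λ _ _ _ → refl
threshold₂-exchange (suc zero)          = exchange-ext or-gate (λ x y w → ∨-exchange y x w)
  where
  or-gate : ∀ a b → threshold₂ 1 a b ≡ a ∨ b
  or-gate true  _     = refl
  or-gate false true  = refl
  or-gate false false = refl
threshold₂-exchange (suc (suc zero))    = exchange-ext and-gate (λ x y w → ∧-exchange y x w)
  where
  and-gate : ∀ a b → threshold₂ 2 a b ≡ a ∧ b
  and-gate true  true  = refl
  and-gate true  false = refl
  and-gate false true  = refl
  and-gate false false = refl
threshold₂-exchange (suc (suc (suc d))) = exchange-ext never (λ _ _ _ → refl)
  where
  never : ∀ a b → threshold₂ (3 + d) a b ≡ false
  never true  true  = refl
  never true  false = refl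
  never false true  = refl
  never false false = refl

maj-snoc₂ : ∀ {k} (z : Vector Bool k) a b →
            Maj (suc (suc k)) (snoc (snoc z a) b) ≡ threshold₂ (⌈ suc (suc k) /2⌉ ∸ count1 z) a b
maj-snoc₂ {k} z a b = begin
  ⌈ suc (suc k) /2⌉ ≤ᵇ count1 (snoc (snoc z a) b)
    ≡⟨ cong (⌈ suc (suc k) /2⌉ ≤ᵇ_) counts ⟩
  ⌈ suc (suc k) /2⌉ ≤ᵇ count1 z + (bit a + bit b)
    ≡⟨ ≤ᵇ-∸ ⌈ suc (suc k) /2⌉ (count1 z) (bit a + bit b) ⟩
  threshold₂ (⌈ suc (suc k) /2⌉ ∸ count1 z) a b ∎
  where
  counts : count1 (snoc (snoc z a) b) ≡ count1 z + (bit a + bit b)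
  counts = trans (count1-snoc (snoc z a) b)
                 (trans (cong (_+ bit b) (count1-snoc z a)) (+-assoc (count1 z) (bit a) (bit b)))

associativity : ∀ {k} (z : Vector Bool k) → Exchange (λ a b → Maj (suc (suc k)) (snoc (snoc z a) b))
associativity {k} z = exchange-ext (maj-snoc₂ z) (threshold₂-exchange (⌈ suc (suc k) /2⌉ ∸ count1 z))

maj-snoc : ∀ {k} (x : Vector Bool k) b → Maj (suc k) (snoc x b) ≡ (⌈ suc k /2⌉ ∸ count1 x ≤ᵇ bit b)
maj-snoc {k} x b =
  trans (cong (⌈ suc k /2⌉ ≤ᵇ_) (count1-snoc x b)) (≤ᵇ-∸ ⌈ suc k /2⌉ (count1 x) (bit b))

threshold₁-cases : ∀ d → (∀ b → (d ≤ᵇ bit b) ≡ true) ⊎ (∀ b → (d ≤ᵇ bit b) ≡ b)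
                                                     ⊎ (∀ b → (d ≤ᵇ bit b) ≡ false)
threshold₁-cases zero          = inj₁ (λ _ → refl)
threshold₁-cases (suc zero)    = inj₂ (inj₁ λ { true → refl ; false → refl })
threshold₁-cases (suc (suc d)) = inj₂ (inj₂ λ { true → refl ; false → refl })

-- (f y₁, …, f y_r, y_{r+1}, …, y_n): the right-hand side of distributivity.
applyPrefix : ∀ {n} → (Bool → Bool) → ℕ → Vector Bool n → Vector Bool n
applyPrefix f r y l = if toℕ l <ᵇ r then f (y l) else y l

applyPrefix-id : ∀ {n} f r (y : Vector Bool n) → (∀ b → f b ≡ b) → ∀ l → applyPrefix f r y l ≡ y l
applyPrefix-id f r y f-id l with toℕ l <ᵇ r
... | true  = f-id (y l)
... | false = refl

applyPrefix-const : ∀ {n} f r (y : Vector Bool n) c → (∀ b → f b ≡ c) →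
                    ∀ l → (toℕ l <ᵇ r) ≡ true → applyPrefix f r y l ≡ c
applyPrefix-const f r y c f-const l with toℕ l <ᵇ r
... | true  = λ _ → f-const (y l)
... | false = λ ()

module OddArity (h : ℕ) {k : ℕ} (k≡h+h : k ≡ h + h) where

  n : ℕ
  n = suc k

  ⌈n/2⌉≡h+1 : ⌈ n /2⌉ ≡ suc h
  ⌈n/2⌉≡h+1 = cong suc (trans (cong ⌊_/2⌋ k≡h+h) (sym (n≡⌊n+n/2⌋ h)))

  maj-threshold : (x : Vector Bool n) → Maj n x ≡ (suc h ≤ᵇ count1 x)
  maj-threshold x = cong (_≤ᵇ count1 x) ⌈n/2⌉≡h+1

  -- Inverter propagation: x has fewer than h+1 ones iff ¬x has at least h+1.
  inverter : (x : Vector Bool n) → not (Maj n x) ≡ Maj n (not ∘ x)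
  inverter x = begin
    not (Maj n x)                 ≡⟨ cong not (maj-threshold x) ⟩
    not (suc h ≤ᵇ count1 x)       ≡⟨ threshold-complement h (count1 x) (count1 (not ∘ x)) total ⟩
    suc h ≤ᵇ count1 (not ∘ x)     ≡⟨ maj-threshold (not ∘ x) ⟨
    Maj n (not ∘ x)               ∎
    where
    total : count1 x + count1 (not ∘ x) ≡ suc (h + h)
    total = trans (count1-complement x) (cong suc k≡h+h)

  majority : (x : Vector Bool n) (y : Bool) → ⌈ n /2⌉ ≤ countEq y x → Maj n x ≡ y
  majority x true  many = ≤ᵇ-true (≤-trans many (≤-reflexive (countEq-true x)))
  majority x false many = begin
    Maj n x                  ≡⟨ not-involutive (Maj n x) ⟨
    not (not (Maj n x))      ≡⟨ cong not (inverter x) ⟩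
    not (Maj n (not ∘ x))    ≡⟨ cong not (majority (not ∘ x) true (≤-trans many (≤-reflexive (countEq-false x)))) ⟩
    false                    ∎

  majority-prefix : ∀ r (c : Bool) → ⌈ n /2⌉ ≤ r → r ≤ n → (z : Vector Bool n) →
                    (∀ l → (toℕ l <ᵇ r) ≡ true → z l ≡ c) → Maj n z ≡ c
  majority-prefix r c t≤r r≤n z prefix-is-c =
    majority z c (≤-trans t≤r (≤-trans (≤-reflexive (sym (count1-prefix r r≤n)))
                                       (count1-mono _ _ agrees)))
    where
    agrees : ∀ l → (toℕ l <ᵇ r) ≡ true → ⌊ z l ≟B c ⌋ ≡ true
    agrees l l<r = trans (cong (λ b → ⌊ b ≟B c ⌋) (prefix-is-c l l<r)) (≟B-refl c)
      where
      ≟B-refl : ∀ b → ⌊ b ≟B b ⌋ ≡ true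
      ≟B-refl true  = refl
      ≟B-refl false = refl

  -- Distributivity: with f b = M_n(x, b) a unary gate, both sides equal
  -- M_n y when f is the identity, and equal c when f is constantly c.
  distributivity : ∀ r → ⌈ n /2⌉ ≤ r → r ≤ n → (x : Vector Bool k) (y : Vector Bool n) →
                   Maj n (snoc x (Maj n y)) ≡ Maj n (applyPrefix (λ b → Maj n (snoc x b)) r y)
  distributivity r t≤r r≤n x y = by-gate (threshold₁-cases (⌈ n /2⌉ ∸ count1 x))
    where
    f : Bool → Bool
    f b = Maj n (snoc x b)

    Gate : (Bool → Bool) → Set
    Gate g = ∀ b → (⌈ n /2⌉ ∸ count1 x ≤ᵇ bit b) ≡ g b

    gate-is : ∀ {g} → Gate g → ∀ b → f b ≡ g b
    gate-is gate b = trans (maj-snoc x b) (gate b)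

    constant-case : ∀ c → Gate (λ _ → c) → f (Maj n y) ≡ Maj n (applyPrefix f r y)
    constant-case c gate = trans (gate-is gate (Maj n y)) (sym
      (majority-prefix r c t≤r r≤n _ (applyPrefix-const f r y c (gate-is gate))))

    identity-case : Gate (λ b → b) → f (Maj n y) ≡ Maj n (applyPrefix f r y)
    identity-case gate = begin
      f (Maj n y)                ≡⟨ gate-is gate (Maj n y) ⟩
      Maj n y                    ≡⟨ cong (⌈ n /2⌉ ≤ᵇ_) (count1-ext _ _ (applyPrefix-id f r y (gate-is gate))) ⟨
      Maj n (applyPrefix f r y)  ∎

    by-gate : Gate (λ _ → true) ⊎ Gate (λ b → b) ⊎ Gate (λ _ → false) →
              f (Maj n y) ≡ Maj n (applyPrefix f r y)
    by-gate (inj₁ always)          = constant-case true always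
    by-gate (inj₂ (inj₁ identity)) = identity-case identity
    by-gate (inj₂ (inj₂ never))    = constant-case false never

-- n = 2m + 3 = 2h + 1 with h = m + 1.
arity-odd : ∀ m → suc (suc (2 * m)) ≡ suc m + suc m
arity-odd = solve-∀

theorem1 : (m : ℕ) →
    let k = suc (2 * m)
        n = suc (suc k)
    in
    -- (1) commutativity
    ((i j : Fin n) → toℕ i < toℕ j → (x : Vector Bool n) →
        Maj n x ≡ Maj n (swapEntries x i j))
    ×
    -- (2a) majority
    ((x : Vector Bool n) (y : Bool) → ⌈ n /2⌉ ≤ countEq y x → Maj n x ≡ y)
    ×
    -- (2b) cancellation of a complementary pair
    ((x : Vector Bool n) (i j : Fin n) (i≢j : ¬ (i ≡ j)) → x j ≡ not (x i) →
        Maj n x ≡ Maj k (removeTwo x i j i≢j))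
    ×
    -- (3) associativity
    ((z : Vector Bool k) (x y w : Bool) →
        Maj n (snoc (snoc z y) (Maj n (snoc (snoc z x) w)))
          ≡ Maj n (snoc (snoc z x) (Maj n (snoc (snoc z y) w))))
    ×
    -- (4) distributivity
    ((r : ℕ) → ⌈ n /2⌉ ≤ r → r ≤ suc k →
      (x : Vector Bool (suc k)) (y : Vector Bool n) →
        Maj n (snoc x (Maj n y))
          ≡ Maj n (λ l → if toℕ l <ᵇ r then Maj n (snoc x (y l)) else y l))
    ×
    -- (5) inverter propagation
    ((x : Vector Bool n) → not (Maj n x) ≡ Maj n (λ l → not (x l)))
theorem1 m =
    (λ i j i<j x → commutativity x i j (<⇒≢ i<j))
  , majority
  , cancellation
  , associativity
  , (λ r t≤r r≤n-1 → distributivity r t≤r (m≤n⇒m≤1+n r≤n-1))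
  , inverter
  where open OddArity (suc m) (arity-odd m)
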